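{- Let $\sqrt[3]{2} = [b_0; b_1, b_2, \ldots]$ be the regular continued fraction expansion, with convergents $\frac{p_n}{q_n} = [b_0; b_1, \ldots, b_n]$ ($p_n,q_n$ coprime positive integers), and let $d_n = 2 q_n^3 - p_n^3$. Define the 2nd quality $Q_n = \frac{\ln(2 q_n^3)}{\ln(2\, d_n\, p_n\, q_n)}$ if $d_n > 0$ and $Q_n = \frac{\ln(p_n^3)}{\ln(2\,|d_n|\, p_n\, q_n)}$ if $d_n < 0$. If $b_{n+1} > 6$, then the resulting equation from $\frac{p_n}{q_n}$ is an ABC hit regarding the 2nd quality, i.e. $Q_n > 1$.
   Context: The resulting equation of the convergent $p_n/q_n$ of $\sqrt[3]{2}$ is $d_n + p_n^3 = 2 q_n^3$ if $d_n>0$ and $-d_n + 2q_n^3 = p_n^3$ if $d_n<0$. "ABC hit regarding the 2nd quality" means that the 2nd quality exceeds $1$. -}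

module Defs where

open import Data.Nat using (ℕ; zero; suc; _+_; _*_; _∸_; _^_; _<_; _≤_)
open import Data.Product using (_×_)
open import Data.Sum using (_⊎_)

-- Continuant recursion with shifted index:
--   P b 0 = p_{-2} = 0,  P b 1 = p_{-1} = 1,  P b (n+2) = b n * P b (n+1) + P b n
--   Q b 0 = q_{-2} = 1,  Q b 1 = q_{-1} = 0,  Q b (n+2) = b n * Q b (n+1) + Q b n
-- so that p_n = P b (n + 2) and q_n = Q b (n + 2).
P : (ℕ → ℕ) → ℕ → ℕ
P b zero = 0
P b (suc zero) = 1
P b (suc (suc n)) = b n * P b (suc n) + P b n

Q : (ℕ → ℕ) → ℕ → ℕ
Q b zero = 1
Q b (suc zero) = 0
Q b (suc (suc n)) = b n * Q b (suc n) + Q b n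

conv-p : (ℕ → ℕ) → ℕ → ℕ
conv-p b n = P b (suc (suc n))

conv-q : (ℕ → ℕ) → ℕ → ℕ
conv-q b n = Q b (suc (suc n))

-- "2^(1/3) lies strictly between x/y and u/v" (y, v > 0), stated by comparing cubes:
--   x/y < 2^(1/3)  iff  x^3 < 2 y^3,   etc.
Cbrt2Between : ℕ → ℕ → ℕ → ℕ → Set
Cbrt2Between x y u v =
  (x ^ 3 < 2 * y ^ 3 × 2 * v ^ 3 < u ^ 3) ⊎ (u ^ 3 < 2 * v ^ 3 × 2 * y ^ 3 < x ^ 3)

-- b is the regular continued fraction expansion [b_0; b_1, b_2, ...] of 2^(1/3):
-- b_n ≥ 1 for n ≥ 1, and b_n = floor(x_n) where x_n is the n-th complete quotient,
-- i.e. 2^(1/3) = (x_n p_{n-1} + p_{n-2}) / (x_n q_{n-1} + q_{n-2}) with b_n ≤ x_n < b_n + 1.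
-- Since t ↦ (t p_{n-1} + p_{n-2}) / (t q_{n-1} + q_{n-2}) is monotone on t ≥ 0 and
-- 2^(1/3) is irrational, b_n ≤ x_n < b_n + 1 holds iff 2^(1/3) lies strictly between
-- the values of this map at t = b_n and t = b_n + 1.
IsCFCbrt2 : (ℕ → ℕ) → Set
IsCFCbrt2 b =
  (∀ n → 1 ≤ b (suc n)) ×
  (∀ n → Cbrt2Between
           (b n * P b (suc n) + P b n)       (b n * Q b (suc n) + Q b n)
           (suc (b n) * P b (suc n) + P b n) (suc (b n) * Q b (suc n) + Q b n))

-- "The resulting equation from p/q is an ABC hit regarding the 2nd quality", Q > 1.
-- Case d = 2q^3 - p^3 > 0:  ln(2q^3) / ln(2 d p q) > 1  ⇔  2 d p q < 2 q^3
-- Case d < 0 (|d| = p^3 - 2q^3): ln(p^3) / ln(2 |d| p q) > 1  ⇔  2 |d| p q < p^3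
-- (the denominators' logarithms are positive since 2|d|pq ≥ 2).
ABCHit2 : ℕ → ℕ → Set
ABCHit2 p q =
  (p ^ 3 < 2 * q ^ 3 × 2 * (2 * q ^ 3 ∸ p ^ 3) * p * q < 2 * q ^ 3) ⊎
  (2 * q ^ 3 < p ^ 3 × 2 * (p ^ 3 ∸ 2 * q ^ 3) * p * q < p ^ 3)

{-# OPTIONS --safe #-}
module Submission where

-- Of the two fractions (c p + p') / (c q + q'), c = b_{n+1} and c = b_{n+1} + 1, which
-- bracket ∛2 by the definition of b_{n+1}, one lies on the other side of ∛2 from
-- p / q = p_n / q_n; call it u / v. Then |u q - p v| = 1, so the cubes (p v)^3 and
-- (u q)^3 of consecutive integers enclose 2 q^3 v^3 = (p v)^3 ± |d| v^3, which forces
-- |d| v ≤ 3 p^2. As v ≥ 7 q this gives 2 |d| p q ≤ (6/7) p^3, and (6/7) p^3 is less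
-- than max(p^3, 2 q^3).

open import Defs
open import Data.Nat.Base
  using (ℕ; zero; suc; _+_; _*_; _∸_; _^_; _≤_; _<_; z≤n; z<s; s≤s⁻¹; NonZero; >-nonZero)
open import Data.Nat.Properties
open import Data.Nat.Solver using (module +-*-Solver)
open import Data.Product using (_,_)
open import Data.Sum using (_⊎_; inj₁; inj₂; swap; map)
open import Function using (_∘_)
open import Relation.Binary.PropositionalEquality using (_≡_; refl; cong; sym; trans; subst₂)
open import Relation.Nullary using (contradiction)

open +-*-Solver using (solve; _:+_; _:*_; _:^_; _:=_; con)

OneApart : ℕ → ℕ → Set
OneApart x y = x ≡ suc y ⊎ y ≡ suc x

oneApart-+ˡ : ∀ k {x y} → OneApart x y → OneApart (k + x) (k + y)
oneApart-+ˡ k {x} {y} = map (shift x y) (shift y x)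
  where
  shift : ∀ m n → m ≡ suc n → k + m ≡ suc (k + n)
  shift m n m≡1+n = trans (cong (k +_) m≡1+n) (+-suc k n)

oneApart-< : ∀ {x y} → OneApart x y → x < y → y ≡ suc x
oneApart-< (inj₁ x≡1+y) x<y = contradiction (≤-reflexive (sym x≡1+y)) (<-asym x<y)
oneApart-< (inj₂ y≡1+x) _   = y≡1+x

record Unimodular (p q u v : ℕ) : Set where
  constructor unimodular
  field cross-oneApart : OneApart (p * v) (u * q)

unimodular-sym : ∀ {p q u v} → Unimodular p q u v → Unimodular u v p q
unimodular-sym (unimodular det) = unimodular (swap det)

unimodular-mediant : ∀ c {p q u v} → Unimodular p q u v → Unimodular p q (c * p + u) (c * q + v)
unimodular-mediant c {p} {q} {u} {v} (unimodular det) =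
  unimodular (subst₂ OneApart (sym (left c p q v)) (sym (right c p q u)) (oneApart-+ˡ (c * p * q) det))
  where
  left : ∀ c p q v → p * (c * q + v) ≡ c * p * q + p * v
  left = solve 4 (λ c p q v → p :* (c :* q :+ v) := c :* p :* q :+ p :* v) refl
  right : ∀ c p q u → (c * p + u) * q ≡ c * p * q + u * q
  right = solve 4 (λ c p q u → (c :* p :+ u) :* q := c :* p :* q :+ u :* q) refl

continuant-unimodular : ∀ b n → Unimodular (P b (suc n)) (Q b (suc n)) (P b n) (Q b n)
continuant-unimodular b zero    = unimodular (inj₁ refl)
continuant-unimodular b (suc n) = unimodular-sym (unimodular-mediant (b n) (continuant-unimodular b n))

m^k<n^k⇒m<n : ∀ k {m n} → m ^ k < n ^ k → m < n
m^k<n^k⇒m<n k mᵏ<nᵏ = ≰⇒> (<⇒≱ mᵏ<nᵏ ∘ ^-monoˡ-≤ k)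

[m*n]^3≡m^3*n^3 : ∀ m n → (m * n) ^ 3 ≡ m ^ 3 * n ^ 3
[m*n]^3≡m^3*n^3 = solve 2 (λ m n → (m :* n) :^ 3 := m :^ 3 :* n :^ 3) refl

[1+m]^3≡m^3+[1+3m[1+m]] : ∀ m → suc m ^ 3 ≡ m ^ 3 + suc (3 * m * suc m)
[1+m]^3≡m^3+[1+3m[1+m]] =
  solve 1 (λ m → (con 1 :+ m) :^ 3 := m :^ 3 :+ (con 1 :+ con 3 :* m :* (con 1 :+ m))) refl

m*n*n^2≡m*n^3 : ∀ m n → m * n * n ^ 2 ≡ m * n ^ 3
m*n*n^2≡m*n^3 = solve 2 (λ m n → m :* n :* n :^ 2 := m :* n :^ 3) refl

2*m*n≡2*n*m : ∀ m n → 2 * m * n ≡ 2 * n * m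
2*m*n≡2*n*m = solve 2 (λ m n → con 2 :* m :* n := con 2 :* n :* m) refl

p^3<2q^3⇒p<2q : ∀ p q → p ^ 3 < 2 * q ^ 3 → p < 2 * q
p^3<2q^3⇒p<2q p q p³<2q³ = m^k<n^k⇒m<n 3 (begin-strict
  p ^ 3       <⟨ p³<2q³ ⟩
  2 * q ^ 3   ≤⟨ *-monoˡ-≤ (q ^ 3) (m≤m+n 2 6) ⟩
  8 * q ^ 3   ≡⟨ [m*n]^3≡m^3*n^3 2 q ⟨
  (2 * q) ^ 3 ∎)
  where open ≤-Reasoning

cbrt2-cross-< : ∀ p q u v → p ^ 3 < 2 * q ^ 3 → 2 * v ^ 3 < u ^ 3 → p * v < u * q
cbrt2-cross-< p zero    u v ()
cbrt2-cross-< p q@(suc _) u v below above = m^k<n^k⇒m<n 3 (begin-strict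
  (p * v) ^ 3       ≡⟨ [m*n]^3≡m^3*n^3 p v ⟩
  p ^ 3 * v ^ 3     ≤⟨ *-monoˡ-≤ (v ^ 3) (<⇒≤ below) ⟩
  2 * q ^ 3 * v ^ 3 ≡⟨ 2*m*n≡2*n*m (q ^ 3) (v ^ 3) ⟩
  2 * v ^ 3 * q ^ 3 <⟨ *-monoˡ-< (q ^ 3) above ⟩
  u ^ 3 * q ^ 3     ≡⟨ [m*n]^3≡m^3*n^3 u q ⟨
  (u * q) ^ 3       ∎)
  where open ≤-Reasoning

defect-bound-below : ∀ p q u v → p ^ 3 < 2 * q ^ 3 → 2 * v ^ 3 < u ^ 3 → u * q ≡ suc (p * v) →
                     3 * p < v → (2 * q ^ 3 ∸ p ^ 3) * v ≤ 3 * p ^ 2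
defect-bound-below p zero    u v ()
defect-bound-below p q@(suc _) u v below above uq≡1+pv 3p<v =
  s≤s⁻¹ (*-cancelʳ-< (v ^ 2) _ _ (begin-strict
    d * v * v ^ 2                 ≡⟨ m*n*n^2≡m*n^3 d v ⟩
    d * v ^ 3                     ≤⟨ s≤s⁻¹ (+-cancelˡ-< (m ^ 3) _ _ gap) ⟩
    3 * m * suc m                 ≡⟨ expand p v ⟩
    3 * p ^ 2 * v ^ 2 + 3 * p * v <⟨ +-monoʳ-< (3 * p ^ 2 * v ^ 2) (*-monoˡ-< v 3p<v) ⟩
    3 * p ^ 2 * v ^ 2 + v * v     ≡⟨ collect p v ⟩
    suc (3 * p ^ 2) * v ^ 2       ∎))
  where
  open ≤-Reasoning
  d = 2 * q ^ 3 ∸ p ^ 3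
  m = p * v
  instance
    v≢0 : NonZero v
    v≢0 = >-nonZero (≤-<-trans z≤n 3p<v)
  expand : ∀ p v → 3 * (p * v) * suc (p * v) ≡ 3 * p ^ 2 * v ^ 2 + 3 * p * v
  expand = solve 2 (λ p v → con 3 :* (p :* v) :* (con 1 :+ p :* v)
                          := con 3 :* p :^ 2 :* v :^ 2 :+ con 3 :* p :* v) refl
  collect : ∀ p v → 3 * p ^ 2 * v ^ 2 + v * v ≡ suc (3 * p ^ 2) * v ^ 2
  collect = solve 2 (λ p v → con 3 :* p :^ 2 :* v :^ 2 :+ v :* v
                           := (con 1 :+ con 3 :* p :^ 2) :* v :^ 2) refl
  gap : m ^ 3 + d * v ^ 3 < m ^ 3 + suc (3 * m * suc m)
  gap = begin-strict
    m ^ 3 + d * v ^ 3           ≡⟨ cong (_+ d * v ^ 3) ([m*n]^3≡m^3*n^3 p v) ⟩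
    p ^ 3 * v ^ 3 + d * v ^ 3   ≡⟨ *-distribʳ-+ (v ^ 3) (p ^ 3) d ⟨
    (p ^ 3 + d) * v ^ 3         ≡⟨ cong (_* v ^ 3) (m+[n∸m]≡n (<⇒≤ below)) ⟩
    2 * q ^ 3 * v ^ 3           ≡⟨ 2*m*n≡2*n*m (q ^ 3) (v ^ 3) ⟩
    2 * v ^ 3 * q ^ 3           <⟨ *-monoˡ-< (q ^ 3) above ⟩
    u ^ 3 * q ^ 3               ≡⟨ [m*n]^3≡m^3*n^3 u q ⟨
    (u * q) ^ 3                 ≡⟨ cong (_^ 3) uq≡1+pv ⟩
    suc m ^ 3                   ≡⟨ [1+m]^3≡m^3+[1+3m[1+m]] m ⟩
    m ^ 3 + suc (3 * m * suc m) ∎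

defect-bound-above : ∀ p q u v → 2 * q ^ 3 < p ^ 3 → u ^ 3 < 2 * v ^ 3 → p * v ≡ suc (u * q) →
                     (p ^ 3 ∸ 2 * q ^ 3) * v < 3 * p ^ 2
defect-bound-above p q u v above below pv≡1+uq =
  *-cancelʳ-< (v ^ 2) _ _ (begin-strict
    d * v * v ^ 2                         ≡⟨ m*n*n^2≡m*n^3 d v ⟩
    d * v ^ 3                             ≤⟨ +-cancelˡ-≤ (m ^ 3) _ _ gap ⟩
    suc (3 * m * suc m)                   <⟨ m<m+n (suc (3 * m * suc m)) z<s ⟩
    suc (3 * m * suc m) + suc (3 * m + 1) ≡⟨ collect m ⟩
    3 * suc m ^ 2                         ≡⟨ cong (λ x → 3 * x ^ 2) pv≡1+uq ⟨
    3 * (p * v) ^ 2                       ≡⟨ distribute p v ⟩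
    3 * p ^ 2 * v ^ 2                     ∎)
  where
  open ≤-Reasoning
  d = p ^ 3 ∸ 2 * q ^ 3
  m = u * q
  collect : ∀ m → suc (3 * m * suc m) + suc (3 * m + 1) ≡ 3 * suc m ^ 2
  collect = solve 1 (λ m → (con 1 :+ con 3 :* m :* (con 1 :+ m)) :+ (con 1 :+ (con 3 :* m :+ con 1))
                         := con 3 :* (con 1 :+ m) :^ 2) refl
  distribute : ∀ p v → 3 * (p * v) ^ 2 ≡ 3 * p ^ 2 * v ^ 2
  distribute = solve 2 (λ p v → con 3 :* (p :* v) :^ 2 := con 3 :* p :^ 2 :* v :^ 2) refl
  -- Only ≤: q = 0 is not excluded, and then u^3 q^3 = 2 v^3 q^3.
  gap : m ^ 3 + d * v ^ 3 ≤ m ^ 3 + suc (3 * m * suc m)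
  gap = begin
    m ^ 3 + d * v ^ 3             ≡⟨ cong (_+ d * v ^ 3) ([m*n]^3≡m^3*n^3 u q) ⟩
    u ^ 3 * q ^ 3 + d * v ^ 3     ≤⟨ +-monoˡ-≤ (d * v ^ 3) (*-monoˡ-≤ (q ^ 3) (<⇒≤ below)) ⟩
    2 * v ^ 3 * q ^ 3 + d * v ^ 3 ≡⟨ cong (_+ d * v ^ 3) (2*m*n≡2*n*m (v ^ 3) (q ^ 3)) ⟩
    2 * q ^ 3 * v ^ 3 + d * v ^ 3 ≡⟨ *-distribʳ-+ (v ^ 3) (2 * q ^ 3) d ⟨
    (2 * q ^ 3 + d) * v ^ 3       ≡⟨ cong (_* v ^ 3) (m+[n∸m]≡n (<⇒≤ above)) ⟩
    p ^ 3 * v ^ 3                 ≡⟨ [m*n]^3≡m^3*n^3 p v ⟨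
    (p * v) ^ 3                   ≡⟨ cong (_^ 3) pv≡1+uq ⟩
    suc m ^ 3                     ≡⟨ [1+m]^3≡m^3+[1+3m[1+m]] m ⟩
    m ^ 3 + suc (3 * m * suc m)   ∎

defect-product-bound : ∀ d p q v → d * v ≤ 3 * p ^ 2 → 7 * q ≤ v → 7 * (2 * d * p * q) ≤ 6 * p ^ 3
defect-product-bound d p q v dv≤3p² 7q≤v = begin
  7 * (2 * d * p * q)   ≡⟨ regroup d p q ⟩
  2 * p * (d * (7 * q)) ≤⟨ *-monoʳ-≤ (2 * p) (*-monoʳ-≤ d 7q≤v) ⟩
  2 * p * (d * v)       ≤⟨ *-monoʳ-≤ (2 * p) dv≤3p² ⟩
  2 * p * (3 * p ^ 2)   ≡⟨ collect p ⟩
  6 * p ^ 3             ∎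
  where
  open ≤-Reasoning
  regroup : ∀ d p q → 7 * (2 * d * p * q) ≡ 2 * p * (d * (7 * q))
  regroup = solve 3 (λ d p q → con 7 :* (con 2 :* d :* p :* q) := con 2 :* p :* (d :* (con 7 :* q))) refl
  collect : ∀ p → 2 * p * (3 * p ^ 2) ≡ 6 * p ^ 3
  collect = solve 1 (λ p → con 2 :* p :* (con 3 :* p :^ 2) := con 6 :* p :^ 3) refl

abcHit2-of-neighbour : ∀ {p q u v} → Unimodular p q u v → 7 * q ≤ v → Cbrt2Between p q u v → ABCHit2 p q
abcHit2-of-neighbour {p} {q} {u} {v} (unimodular det) 7q≤v (inj₁ (below , above)) =
  inj₁ (below , *-cancelˡ-< 7 _ _ (begin-strict
    7 * (2 * d * p * q) ≤⟨ defect-product-bound d p q v dv≤3p² 7q≤v ⟩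
    6 * p ^ 3           <⟨ *-monoʳ-< 6 below ⟩
    6 * (2 * q ^ 3)     ≤⟨ *-monoˡ-≤ (2 * q ^ 3) (n≤1+n 6) ⟩
    7 * (2 * q ^ 3)     ∎))
  where
  open ≤-Reasoning
  d = 2 * q ^ 3 ∸ p ^ 3
  3p<v : 3 * p < v
  3p<v = begin-strict
    3 * p       <⟨ *-monoʳ-< 3 (p^3<2q^3⇒p<2q p q below) ⟩
    3 * (2 * q) ≡⟨ *-assoc 3 2 q ⟨
    6 * q       ≤⟨ *-monoˡ-≤ q (n≤1+n 6) ⟩
    7 * q       ≤⟨ 7q≤v ⟩
    v           ∎
  dv≤3p² : d * v ≤ 3 * p ^ 2
  dv≤3p² = defect-bound-below p q u v below above
             (oneApart-< det (cbrt2-cross-< p q u v below above)) 3p<v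
abcHit2-of-neighbour {p} {q} {u} {v} (unimodular det) 7q≤v (inj₂ (below , above)) =
  inj₂ (above , *-cancelˡ-< 7 _ _ (begin-strict
    7 * (2 * d * p * q) ≤⟨ defect-product-bound d p q v (<⇒≤ dv<3p²) 7q≤v ⟩
    6 * p ^ 3           <⟨ *-monoˡ-< (p ^ 3) (n<1+n 6) ⟩
    7 * p ^ 3           ∎))
  where
  open ≤-Reasoning
  d = p ^ 3 ∸ 2 * q ^ 3
  instance
    p³≢0 : NonZero (p ^ 3)
    p³≢0 = >-nonZero (≤-<-trans z≤n above)
  dv<3p² : d * v < 3 * p ^ 2
  dv<3p² = defect-bound-above p q u v above below
             (oneApart-< (swap det) (cbrt2-cross-< u v p q below above))

abcHit2-of-mediant : ∀ b n c → 7 ≤ c →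
                     Cbrt2Between (conv-p b n) (conv-q b n)
                                  (c * conv-p b n + P b (suc n)) (c * conv-q b n + Q b (suc n)) →
                     ABCHit2 (conv-p b n) (conv-q b n)
abcHit2-of-mediant b n c 7≤c =
  abcHit2-of-neighbour (unimodular-mediant c (continuant-unimodular b (suc n)))
                       (≤-trans (*-monoˡ-≤ (conv-q b n) 7≤c) (m≤m+n _ (Q b (suc n))))

mainTheorem2 : (b : ℕ → ℕ) → IsCFCbrt2 b → (n : ℕ) → 6 < b (suc n) →
    ABCHit2 (conv-p b n) (conv-q b n)
mainTheorem2 b (_ , straddles) n 6<bₙ₊₁ with straddles n | straddles (suc n)
... | inj₁ (below , _) | inj₂ (_ , above) =
  abcHit2-of-mediant b n (b (suc n)) 6<bₙ₊₁ (inj₁ (below , above))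
... | inj₂ (_ , above) | inj₁ (below , _) =
  abcHit2-of-mediant b n (b (suc n)) 6<bₙ₊₁ (inj₂ (below , above))
... | inj₁ (below , _) | inj₁ (_ , above) =
  abcHit2-of-mediant b n (suc (b (suc n))) (m≤n⇒m≤1+n 6<bₙ₊₁) (inj₁ (below , above))
... | inj₂ (_ , above) | inj₂ (below , _) =
  abcHit2-of-mediant b n (suc (b (suc n))) (m≤n⇒m≤1+n 6<bₙ₊₁) (inj₂ (below , above))
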